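{- Let $k<n$ be positive integers. If $n$ is even then $\textsc{bm}(k,n,n)\le\min\left(k,\left\lfloor\frac{3n}{4}\right\rfloor\right)$; if $n$ is odd then $\textsc{bm}(k,n,n)\le\min\left(k,\left\lfloor\frac{3n+1}{4}\right\rfloor\right)$. That is, in each case there is a $(k,n,n)$-fractionally balanced tripartite hypergraph with no matching of size larger than the stated bound.
   Context: A hypergraph is identified with its finite edge set; a matching is a set of pairwise disjoint edges. A hypergraph $H$ is $k$-partite with sides $V_1,\ldots,V_k$ (a fixed partition of its vertex set) if $|e\cap V_t|=1$ for every edge $e$ and every $t$. For $f:H\to\mathbb{R}_{\ge0}$, $\deg_f(v)=\sum_{e\ni v}f(e)$; $f$ is balanced if $\deg_f$ is constant on each side. $H$ is $(b_1,\ldots,b_k)$-fractionally balanced if it is $k$-partite with sides of sizes $b_1,\ldots,b_k$ and has a nonzero balanced $f:H\to\mathbb{R}_{\ge0}$. $\textsc{bm}(b_1,\ldots,b_k)$ is the largest $m$ such that every $(b_1,\ldots,b_k)$-fractionally balanced $k$-partite hypergraph has a matching of size $m$. -}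

module Defs where

open import Data.Nat using (ℕ)
import Data.Nat
import Data.Fin
import Data.Product
open import Data.Fin using (Fin)
open import Data.Product using (_×_; _,_; Σ; ∃; ∃-syntax)
open import Data.List using (List; []; _∷_; length; filter; map; foldr)
open import Data.List.Membership.Propositional using (_∈_)
open import Data.List.Relation.Unary.All using (All)
open import Data.List.Relation.Unary.Unique.Propositional using (Unique)
open import Data.List.Relation.Unary.AllPairs using (AllPairs)
open import Data.Rational using (ℚ; 0ℚ; _+_; _≤_)
open import Relation.Binary.PropositionalEquality using (_≡_; _≢_)
open import Relation.Nullary using (¬_)

-- A tripartite hypergraph with sides V₁ = Fin a, V₂ = Fin b, V₃ = Fin c.
-- An edge meets each side in exactly one vertex, so it is a triple.
Edge : ℕ → ℕ → ℕ → Set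
Edge a b c = Fin a × Fin b × Fin c

record Hypergraph (a b c : ℕ) : Set where
  field
    edges  : List (Edge a b c)
    unique : Unique edges
open Hypergraph public

sumℚ : {A : Set} → (A → ℚ) → List A → ℚ
sumℚ f = foldr (λ x s → f x + s) 0ℚ

deg₁ : ∀ {a b c} → Hypergraph a b c → (Edge a b c → ℚ) → Fin a → ℚ
deg₁ H f v = sumℚ f (filter (λ e → Data.Fin._≟_ (Data.Product.proj₁ e) v) (edges H))

deg₂ : ∀ {a b c} → Hypergraph a b c → (Edge a b c → ℚ) → Fin b → ℚ
deg₂ H f v = sumℚ f (filter (λ e → Data.Fin._≟_ (Data.Product.proj₁ (Data.Product.proj₂ e)) v) (edges H))

deg₃ : ∀ {a b c} → Hypergraph a b c → (Edge a b c → ℚ) → Fin c → ℚ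
deg₃ H f v = sumℚ f (filter (λ e → Data.Fin._≟_ (Data.Product.proj₂ (Data.Product.proj₂ e)) v) (edges H))

NonNeg : ∀ {a b c} → Hypergraph a b c → (Edge a b c → ℚ) → Set
NonNeg H f = All (λ e → 0ℚ ≤ f e) (edges H)

NonZero : ∀ {a b c} → Hypergraph a b c → (Edge a b c → ℚ) → Set
NonZero H f = ∃[ e ] (e ∈ edges H × f e ≢ 0ℚ)

Balanced : ∀ {a b c} → Hypergraph a b c → (Edge a b c → ℚ) → Set
Balanced H f =
  (∀ v w → deg₁ H f v ≡ deg₁ H f w) ×
  (∀ v w → deg₂ H f v ≡ deg₂ H f w) ×
  (∀ v w → deg₃ H f v ≡ deg₃ H f w)

FracBalanced : ∀ {a b c} → Hypergraph a b c → Set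
FracBalanced H = ∃[ f ] (NonNeg H f × NonZero H f × Balanced H f)

-- Two edges are disjoint (they can only meet inside a common side).
Disjoint : ∀ {a b c} → Edge a b c → Edge a b c → Set
Disjoint (x , y , z) (x' , y' , z') = x ≢ x' × y ≢ y' × z ≢ z'

-- M is a matching in H (listed without repetition: disjointness forces that).
IsMatching : ∀ {a b c} → Hypergraph a b c → List (Edge a b c) → Set
IsMatching H M = All (_∈ edges H) M × AllPairs Disjoint M

MatchingNumber≤ : ∀ {a b c} → Hypergraph a b c → ℕ → Set
MatchingNumber≤ H m = ∀ M → IsMatching H M → Data.Nat._≤_ (length M) m

bm≤ : ℕ → ℕ → ℕ → ℕ → Set
bm≤ a b c m = Σ (Hypergraph a b c) (λ H → FracBalanced H × MatchingNumber≤ H m)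

-- Write k = 2g + t and n = 2g + s with t < s. On each side, the vertices below 2g form g
-- blocks {2i, 2i+1}; on block i the four words of the even-weight code {000, 011, 101, 110}
-- give four pairwise intersecting edges, and every triple (a, b, c) with b, c ≥ 2g is an edge
-- as well. Integer weights on these edges make all degrees constant on each side, so the
-- hypergraph is fractionally balanced. A matching has at most k edges, and at most s + g:
-- one per block plus at most one through each vertex b ≥ 2g of the second side. Hence
-- bm(k, n, n) ≤ min(k, n − g) whenever 2g ≤ k, and for a target m < k the choice g = n − m
-- satisfies 2g ≤ k exactly because 3n ≤ 4m + 3.

module Submission where

open import Defs
open import Data.Bool using (Bool; true; false; not; _xor_; if_then_else_)
open import Data.Bool.Properties using (not-¬; ¬-not; not-involutive; not-distribˡ-xor; not-distribʳ-xor)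
open import Data.Empty using (⊥)
open import Data.Fin as Fin using (Fin; toℕ; fromℕ<)
open import Data.Fin.Properties using (toℕ<n; toℕ-fromℕ<; toℕ-injective; pigeonhole)
open import Data.List using (List; []; _∷_; length; lookup; foldr; filter; _++_; map; cartesianProduct; tabulate; allFin)
open import Data.List.Properties using (length-map)
open import Data.List.Membership.Propositional using (_∈_)
open import Data.List.Membership.Propositional.Properties
  using (∈-filter⁻; ∈-filter⁺; ∈-cartesianProduct⁺; ∈-allFin; ∈-lookup)
open import Data.List.Relation.Unary.All using (All; []; _∷_)
import Data.List.Relation.Unary.All as All
import Data.List.Relation.Unary.All.Properties as All
open import Data.List.Relation.Unary.AllPairs using (AllPairs; []; _∷_)
import Data.List.Relation.Unary.AllPairs.Properties as AllPairs
import Data.List.Relation.Unary.Unique.Propositional.Properties as Unique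
open import Data.Nat using (ℕ; zero; suc; _<_; _≤_; _⊓_; _*_; _+_; _∸_; _/_; _%_; ⌊_/2⌋; _≟_; _<?_; _≤?_; z≤n; s≤s; z<s; s<s)
open import Data.Nat.Properties
open import Algebra.Properties.CommutativeSemigroup +-commutativeSemigroup using () renaming (interchange to +-interchange)
open import Data.Nat.DivMod using (m≡m%n+[m/n]*n; m%n<n)
open import Data.Nat.Divisibility using (_∣_)
open import Data.Nat.Tactic.RingSolver using (solve-∀)
open import Data.Product using (_×_; _,_; proj₁; proj₂; ∃; ∃-syntax)
open import Data.Rational as ℚ using (ℚ; 0ℚ; 1ℚ)
import Data.Rational.Properties as ℚ
open import Data.Sum using (_⊎_; inj₁; inj₂)
open import Function using (_∘_)
open import Level using (0ℓ)
open import Relation.Binary.PropositionalEquality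
open import Relation.Nullary using (¬_; does; yes; no; contradiction)
open import Relation.Nullary.Decidable using (dec-true; dec-false)
open import Relation.Unary using (Pred; Decidable)

fromℕ : ℕ → ℚ
fromℕ zero    = 0ℚ
fromℕ (suc n) = 1ℚ ℚ.+ fromℕ n

fromℕ-+ : ∀ m n → fromℕ (m + n) ≡ fromℕ m ℚ.+ fromℕ n
fromℕ-+ zero    n = sym (ℚ.+-identityˡ (fromℕ n))
fromℕ-+ (suc m) n = trans (cong (1ℚ ℚ.+_) (fromℕ-+ m n)) (sym (ℚ.+-assoc 1ℚ (fromℕ m) (fromℕ n)))

fromℕ-nonNeg : ∀ n → 0ℚ ℚ.≤ fromℕ n
fromℕ-nonNeg zero    = ℚ.≤-refl
fromℕ-nonNeg (suc n) = ℚ.+-mono-≤ (ℚ.<⇒≤ (ℚ.positive⁻¹ 1ℚ)) (fromℕ-nonNeg n)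

fromℕ-≢0 : ∀ {n} → 0 < n → fromℕ n ≢ 0ℚ
fromℕ-≢0 {suc n} _ = ≢-sym (ℚ.<⇒≢ (ℚ.+-mono-<-≤ (ℚ.positive⁻¹ 1ℚ) (fromℕ-nonNeg n)))

-- Finite sums of natural numbers

sumℕ : {A : Set} → (A → ℕ) → List A → ℕ
sumℕ h = foldr (λ x s → h x + s) 0

sumℚ-fromℕ : {A : Set} (h : A → ℕ) (xs : List A) → sumℚ (λ x → fromℕ (h x)) xs ≡ fromℕ (sumℕ h xs)
sumℚ-fromℕ h []       = refl
sumℚ-fromℕ h (x ∷ xs) = trans (cong (fromℕ (h x) ℚ.+_) (sumℚ-fromℕ h xs)) (sym (fromℕ-+ (h x) (sumℕ h xs)))

sumℕ-cong : {A : Set} {h h′ : A → ℕ} → (∀ x → h x ≡ h′ x) → (xs : List A) → sumℕ h xs ≡ sumℕ h′ xs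
sumℕ-cong h≗h′ []       = refl
sumℕ-cong h≗h′ (x ∷ xs) = cong₂ _+_ (h≗h′ x) (sumℕ-cong h≗h′ xs)

sumℕ-++ : {A : Set} (h : A → ℕ) (xs ys : List A) → sumℕ h (xs ++ ys) ≡ sumℕ h xs + sumℕ h ys
sumℕ-++ h []       ys = refl
sumℕ-++ h (x ∷ xs) ys = trans (cong (h x +_) (sumℕ-++ h xs ys)) (sym (+-assoc (h x) _ _))

sumℕ-map : {A B : Set} (h : B → ℕ) (f : A → B) (xs : List A) → sumℕ h (map f xs) ≡ sumℕ (λ x → h (f x)) xs
sumℕ-map h f []       = refl
sumℕ-map h f (x ∷ xs) = cong (h (f x) +_) (sumℕ-map h f xs)

sumℕ-cartesianProduct : {A B : Set} (h : A × B → ℕ) (xs : List A) (ys : List B) →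
  sumℕ h (cartesianProduct xs ys) ≡ sumℕ (λ x → sumℕ (λ y → h (x , y)) ys) xs
sumℕ-cartesianProduct h []       ys = refl
sumℕ-cartesianProduct h (x ∷ xs) ys = trans (sumℕ-++ h (map (x ,_) ys) _)
  (cong₂ _+_ (sumℕ-map h (x ,_) ys) (sumℕ-cartesianProduct h xs ys))

sumℕ-filter : {A : Set} {P : Pred A 0ℓ} (P? : Decidable P) (h : A → ℕ) (xs : List A) →
  sumℕ h (filter P? xs) ≡ sumℕ (λ x → if does (P? x) then h x else 0) xs
sumℕ-filter P? h []       = refl
sumℕ-filter P? h (x ∷ xs) with does (P? x)
... | false = sumℕ-filter P? h xs
... | true  = cong (h x +_) (sumℕ-filter P? h xs)

sumℕ-filter-⊇-support : {A : Set} {P : Pred A 0ℓ} (P? : Decidable P) (h : A → ℕ) →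
  (∀ x → ¬ P x → h x ≡ 0) → (xs : List A) → sumℕ h (filter P? xs) ≡ sumℕ h xs
sumℕ-filter-⊇-support P? h h-vanishes []       = refl
sumℕ-filter-⊇-support P? h h-vanishes (x ∷ xs) with P? x
... | yes _  = cong (h x +_) (sumℕ-filter-⊇-support P? h h-vanishes xs)
... | no ¬px = trans (sumℕ-filter-⊇-support P? h h-vanishes xs) (cong (_+ sumℕ h xs) (sym (h-vanishes x ¬px)))

∑< : ℕ → (ℕ → ℕ) → ℕ
∑< zero    F = 0
∑< (suc n) F = F 0 + ∑< n (λ i → F (suc i))
syntax ∑< n (λ i → x) = ∑[ i < n ] x

sumℕ-tabulate : ∀ n {A : Set} (f : Fin n → A) (h : A → ℕ) (F : ℕ → ℕ) →
  (∀ i → h (f i) ≡ F (toℕ i)) → sumℕ h (tabulate f) ≡ ∑[ i < n ] F i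
sumℕ-tabulate zero    f h F h∘f≗F = refl
sumℕ-tabulate (suc n) f h F h∘f≗F =
  cong₂ _+_ (h∘f≗F Fin.zero) (sumℕ-tabulate n (λ i → f (Fin.suc i)) h (λ i → F (suc i)) (λ i → h∘f≗F (Fin.suc i)))

sumℕ-allFin : ∀ n (F : ℕ → ℕ) → sumℕ (λ i → F (toℕ i)) (allFin n) ≡ ∑[ i < n ] F i
sumℕ-allFin n F = sumℕ-tabulate n (λ i → i) (λ i → F (toℕ i)) F (λ i → refl)

∑-cong : ∀ n {F G : ℕ → ℕ} → (∀ i → i < n → F i ≡ G i) → ∑[ i < n ] F i ≡ ∑[ i < n ] G i
∑-cong zero    F≗G = refl
∑-cong (suc n) F≗G = cong₂ _+_ (F≗G 0 z<s) (∑-cong n (λ i i<n → F≗G (suc i) (s<s i<n)))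

∑-const : ∀ n c → ∑[ i < n ] c ≡ n * c
∑-const zero    c = refl
∑-const (suc n) c = cong (c +_) (∑-const n c)

∑-zero : ∀ n → ∑[ i < n ] 0 ≡ 0
∑-zero n = trans (∑-const n 0) (*-zeroʳ n)

∑-distrib-+ : ∀ n (F G : ℕ → ℕ) → ∑[ i < n ] (F i + G i) ≡ ∑[ i < n ] F i + ∑[ i < n ] G i
∑-distrib-+ zero    F G = refl
∑-distrib-+ (suc n) F G = trans (cong (F 0 + G 0 +_) (∑-distrib-+ n _ _)) (+-interchange (F 0) (G 0) _ _)

*-distribˡ-∑ : ∀ n c (F : ℕ → ℕ) → ∑[ i < n ] (c * F i) ≡ c * ∑[ i < n ] F i
*-distribˡ-∑ zero    c F = sym (*-zeroʳ c)
*-distribˡ-∑ (suc n) c F = trans (cong (c * F 0 +_) (*-distribˡ-∑ n c _)) (sym (*-distribˡ-+ c (F 0) _))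

*-distribʳ-∑ : ∀ n c (F : ℕ → ℕ) → ∑[ i < n ] (F i * c) ≡ ∑[ i < n ] F i * c
*-distribʳ-∑ n c F = trans (∑-cong n (λ i _ → *-comm (F i) c)) (trans (*-distribˡ-∑ n c F) (*-comm c _))

∑-comm : ∀ n m (F : ℕ → ℕ → ℕ) → ∑[ i < n ] ∑[ j < m ] F i j ≡ ∑[ j < m ] ∑[ i < n ] F i j
∑-comm zero    m F = sym (∑-zero m)
∑-comm (suc n) m F = trans (cong (∑[ j < m ] F 0 j +_) (∑-comm n m (λ i j → F (suc i) j)))
  (sym (∑-distrib-+ m (F 0) (λ j → ∑[ i < n ] F (suc i) j)))

∑∑-distrib-+ : ∀ n m (F G : ℕ → ℕ → ℕ) →
  ∑[ i < n ] ∑[ j < m ] (F i j + G i j) ≡ ∑[ i < n ] ∑[ j < m ] F i j + ∑[ i < n ] ∑[ j < m ] G i j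
∑∑-distrib-+ n m F G = trans (∑-cong n (λ i _ → ∑-distrib-+ m (F i) (G i))) (∑-distrib-+ n _ _)

*-distribˡ-∑∑ : ∀ n m c (F : ℕ → ℕ → ℕ) → ∑[ i < n ] ∑[ j < m ] (c * F i j) ≡ c * ∑[ i < n ] ∑[ j < m ] F i j
*-distribˡ-∑∑ n m c F = trans (∑-cong n (λ i _ → *-distribˡ-∑ m c (F i))) (*-distribˡ-∑ n c _)

∑∑-linear : ∀ n m c (G F : ℕ → ℕ → ℕ) →
  ∑[ i < n ] ∑[ j < m ] (c * G i j + F i j) ≡ c * ∑[ i < n ] ∑[ j < m ] G i j + ∑[ i < n ] ∑[ j < m ] F i j
∑∑-linear n m c G F = trans (∑∑-distrib-+ n m _ F) (cong (_+ _) (*-distribˡ-∑∑ n m c G))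

∑∑-* : ∀ n m (U V : ℕ → ℕ) → ∑[ i < n ] ∑[ j < m ] (U i * V j) ≡ ∑[ i < n ] U i * ∑[ j < m ] V j
∑∑-* n m U V = trans (∑-cong n (λ i _ → *-distribˡ-∑ m (U i) V)) (*-distribʳ-∑ n (∑[ j < m ] V j) U)

∑-if : ∀ n B (F : ℕ → ℕ) → ∑[ i < n ] (if B then F i else 0) ≡ (if B then ∑[ i < n ] F i else 0)
∑-if n true  F = refl
∑-if n false F = ∑-zero n

∑-select : ∀ n v (F : ℕ → ℕ) → v < n → ∑[ i < n ] (if does (i ≟ v) then F i else 0) ≡ F v
∑-select (suc n) zero    F _         = trans (cong (F 0 +_) (∑-zero n)) (+-identityʳ (F 0))
∑-select (suc n) (suc v) F (s<s v<n) = ∑-select n v (λ i → F (suc i)) v<n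

∑-count-≥ : ∀ n m → ∑[ i < n ] (if does (i <? m) then 0 else 1) ≡ n ∸ m
∑-count-≥ zero    zero    = refl
∑-count-≥ zero    (suc m) = refl
∑-count-≥ (suc n) zero    = cong suc (trans (∑-const n 1) (*-identityʳ n))
∑-count-≥ (suc n) (suc m) = ∑-count-≥ n m

δ : ℕ → ℕ → ℕ
δ a b = if does (a ≟ b) then 1 else 0

δ-sym : ∀ a b → δ a b ≡ δ b a
δ-sym zero    zero    = refl
δ-sym zero    (suc b) = refl
δ-sym (suc a) zero    = refl
δ-sym (suc a) (suc b) = δ-sym a b

∑-δ : ∀ n v → ∑[ j < n ] δ v j ≡ (if does (v <? n) then 1 else 0)
∑-δ zero    v       = refl
∑-δ (suc n) zero    = cong suc (∑-zero n)
∑-δ (suc n) (suc v) = ∑-δ n v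

∑-δ-< : ∀ n v → v < n → ∑[ j < n ] δ j v ≡ 1
∑-δ-< n v v<n = begin
  ∑[ j < n ] δ j v                       ≡⟨ ∑-cong n (λ j _ → δ-sym j v) ⟩
  ∑[ j < n ] δ v j                       ≡⟨ ∑-δ n v ⟩
  (if does (v <? n) then 1 else 0)       ≡⟨ cong (if_then 1 else 0) (dec-true (v <? n) v<n) ⟩
  1                                      ∎
  where open ≡-Reasoning

∑∑-δδ : ∀ n m X q r → q < n → r < m → ∑[ b < n ] ∑[ c < m ] (X * δ b q * δ c r) ≡ X
∑∑-δδ n m X q r q<n r<m = begin
  ∑[ b < n ] ∑[ c < m ] (X * δ b q * δ c r)      ≡⟨ ∑∑-* n m (λ b → X * δ b q) (λ c → δ c r) ⟩
  ∑[ b < n ] (X * δ b q) * ∑[ c < m ] δ c r      ≡⟨ cong₂ _*_ (*-distribˡ-∑ n X (λ b → δ b q)) (∑-δ-< m r r<m) ⟩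
  X * ∑[ b < n ] δ b q * 1                       ≡⟨ cong (λ s → X * s * 1) (∑-δ-< n q q<n) ⟩
  X * 1 * 1                                      ≡⟨ trans (*-identityʳ _) (*-identityʳ X) ⟩
  X                                              ∎
  where open ≡-Reasoning

+-positive : ∀ x y → 0 < x + y → 0 < x ⊎ 0 < y
+-positive zero    y 0<y = inj₂ 0<y
+-positive (suc x) y _   = inj₁ z<s

*-positive : ∀ x y → 0 < x * y → 0 < x × 0 < y
*-positive (suc x) (suc y) _ = z<s , z<s
*-positive (suc x) zero    0<x*0 = contradiction (*-zeroʳ (suc x)) (>⇒≢ 0<x*0)

∑-positive : ∀ n (F : ℕ → ℕ) → 0 < ∑[ i < n ] F i → ∃[ i ] (i < n × 0 < F i)
∑-positive (suc n) F 0<∑ with +-positive (F 0) _ 0<∑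
... | inj₁ 0<F0 = 0 , z<s , 0<F0
... | inj₂ 0<∑′ with ∑-positive n (λ i → F (suc i)) 0<∑′
...   | i , i<n , 0<Fi = suc i , s<s i<n , 0<Fi

δ-positive : ∀ a b → 0 < δ a b → a ≡ b
δ-positive zero    zero    _   = refl
δ-positive (suc a) (suc b) 0<δ = cong suc (δ-positive a b 0<δ)

δδδ-positive : ∀ a b c p q r → 0 < δ a p * δ b q * δ c r → a ≡ p × b ≡ q × c ≡ r
δδδ-positive a b c p q r 0<δδδ with *-positive (δ a p * δ b q) (δ c r) 0<δδδ
... | 0<δδ , 0<δc with *-positive (δ a p) (δ b q) 0<δδ
...   | 0<δa , 0<δb = δ-positive a p 0<δa , δ-positive b q 0<δb , δ-positive c r 0<δc

-- The support of a weighting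

does-≟-toℕ : ∀ {n} (x v : Fin n) → does (x Fin.≟ v) ≡ does (toℕ x ≟ toℕ v)
does-≟-toℕ Fin.zero    Fin.zero    = refl
does-≟-toℕ Fin.zero    (Fin.suc v) = refl
does-≟-toℕ (Fin.suc x) Fin.zero    = refl
does-≟-toℕ (Fin.suc x) (Fin.suc v) = does-≟-toℕ x v

module Support {a b c : ℕ} (w : ℕ → ℕ → ℕ → ℕ) where

  weightOf : Edge a b c → ℕ
  weightOf (x , y , z) = w (toℕ x) (toℕ y) (toℕ z)

  triples : List (Edge a b c)
  triples = cartesianProduct (allFin a) (cartesianProduct (allFin b) (allFin c))

  support : Hypergraph a b c
  support = record
    { edges  = filter (λ e → 0 <? weightOf e) triples
    ; unique = Unique.filter⁺ _ (Unique.cartesianProduct⁺ (Unique.allFin⁺ a)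
                 (Unique.cartesianProduct⁺ (Unique.allFin⁺ b) (Unique.allFin⁺ c)))
    }

  weighting : Edge a b c → ℚ
  weighting e = fromℕ (weightOf e)

  ∈support⇒positive : ∀ {e} → e ∈ edges support → 0 < weightOf e
  ∈support⇒positive {e} e∈ = proj₂ (∈-filter⁻ (λ e → 0 <? weightOf e) {xs = triples} e∈)

  sumℕ-triples : (F : ℕ → ℕ → ℕ → ℕ) →
    sumℕ (λ e → F (toℕ (proj₁ e)) (toℕ (proj₁ (proj₂ e))) (toℕ (proj₂ (proj₂ e)))) triples ≡
    ∑[ x < a ] ∑[ y < b ] ∑[ z < c ] F x y z
  sumℕ-triples F = begin
    sumℕ _ triples
      ≡⟨ sumℕ-cartesianProduct _ (allFin a) _ ⟩
    sumℕ (λ x → sumℕ _ (cartesianProduct (allFin b) (allFin c))) (allFin a)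
      ≡⟨ sumℕ-cong (λ x → sumℕ-cartesianProduct _ (allFin b) (allFin c)) (allFin a) ⟩
    sumℕ (λ x → sumℕ (λ y → sumℕ (λ z → F (toℕ x) (toℕ y) (toℕ z)) (allFin c)) (allFin b)) (allFin a)
      ≡⟨ sumℕ-cong (λ x → sumℕ-cong (λ y → sumℕ-allFin c (F (toℕ x) (toℕ y))) (allFin b)) (allFin a) ⟩
    sumℕ (λ x → sumℕ (λ y → ∑[ z < c ] F (toℕ x) (toℕ y) z) (allFin b)) (allFin a)
      ≡⟨ sumℕ-cong (λ x → sumℕ-allFin b (λ y → ∑[ z < c ] F (toℕ x) y z)) (allFin a) ⟩
    sumℕ (λ x → ∑[ y < b ] ∑[ z < c ] F (toℕ x) y z) (allFin a)
      ≡⟨ sumℕ-allFin a (λ x → ∑[ y < b ] ∑[ z < c ] F x y z) ⟩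
    ∑[ x < a ] ∑[ y < b ] ∑[ z < c ] F x y z ∎
    where open ≡-Reasoning

  sumℚ-filter-support : {P : Pred (Edge a b c) 0ℓ} (P? : Decidable P) (G : ℕ → ℕ → ℕ → ℕ) →
    (∀ e → (if does (P? e) then weightOf e else 0) ≡ G (toℕ (proj₁ e)) (toℕ (proj₁ (proj₂ e))) (toℕ (proj₂ (proj₂ e)))) →
    sumℚ weighting (filter P? (edges support)) ≡ fromℕ (∑[ x < a ] ∑[ y < b ] ∑[ z < c ] G x y z)
  sumℚ-filter-support P? G restrict≗G = begin
    sumℚ weighting (filter P? (edges support))
      ≡⟨ sumℚ-fromℕ weightOf (filter P? (edges support)) ⟩
    fromℕ (sumℕ weightOf (filter P? (edges support)))
      ≡⟨ cong fromℕ (sumℕ-filter P? weightOf (edges support)) ⟩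
    fromℕ (sumℕ restrict (edges support))
      ≡⟨ cong fromℕ (sumℕ-filter-⊇-support (λ e → 0 <? weightOf e) restrict restrict-vanishes triples) ⟩
    fromℕ (sumℕ restrict triples)
      ≡⟨ cong fromℕ (trans (sumℕ-cong restrict≗G triples) (sumℕ-triples G)) ⟩
    fromℕ (∑[ x < a ] ∑[ y < b ] ∑[ z < c ] G x y z) ∎
    where
    open ≡-Reasoning
    restrict : Edge a b c → ℕ
    restrict e = if does (P? e) then weightOf e else 0
    restrict-vanishes : ∀ e → ¬ 0 < weightOf e → restrict e ≡ 0
    restrict-vanishes e w≯0 with does (P? e)
    ... | true  = n≤0⇒n≡0 (≮⇒≥ w≯0)
    ... | false = refl

  deg₁-support : ∀ v → deg₁ support weighting v ≡ fromℕ (∑[ y < b ] ∑[ z < c ] w (toℕ v) y z)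
  deg₁-support v = trans
    (sumℚ-filter-support (λ e → proj₁ e Fin.≟ v) (λ x y z → if does (x ≟ toℕ v) then w x y z else 0)
      (λ (x , y , z) → cong (if_then weightOf (x , y , z) else 0) (does-≟-toℕ x v)))
    (cong fromℕ (trans
      (∑-cong a (λ x _ → trans (∑-cong b (λ y _ → ∑-if c (does (x ≟ toℕ v)) _)) (∑-if b (does (x ≟ toℕ v)) _)))
      (∑-select a (toℕ v) _ (toℕ<n v))))

  deg₂-support : ∀ v → deg₂ support weighting v ≡ fromℕ (∑[ x < a ] ∑[ z < c ] w x (toℕ v) z)
  deg₂-support v = trans
    (sumℚ-filter-support (λ e → proj₁ (proj₂ e) Fin.≟ v) (λ x y z → if does (y ≟ toℕ v) then w x y z else 0)
      (λ (x , y , z) → cong (if_then weightOf (x , y , z) else 0) (does-≟-toℕ y v)))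
    (cong fromℕ (∑-cong a (λ x _ → trans
      (∑-cong b (λ y _ → ∑-if c (does (y ≟ toℕ v)) _))
      (∑-select b (toℕ v) _ (toℕ<n v)))))

  deg₃-support : ∀ v → deg₃ support weighting v ≡ fromℕ (∑[ x < a ] ∑[ y < b ] w x y (toℕ v))
  deg₃-support v = trans
    (sumℚ-filter-support (λ e → proj₂ (proj₂ e) Fin.≟ v) (λ x y z → if does (z ≟ toℕ v) then w x y z else 0)
      (λ (x , y , z) → cong (if_then weightOf (x , y , z) else 0) (does-≟-toℕ z v)))
    (cong fromℕ (∑-cong a (λ x _ → ∑-cong b (λ y _ → ∑-select c (toℕ v) _ (toℕ<n v)))))

  support-fracBalanced : ∀ {D₁ D₂ D₃} →
    (∀ x → ∑[ y < b ] ∑[ z < c ] w x y z ≡ D₁) →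
    (∀ y → ∑[ x < a ] ∑[ z < c ] w x y z ≡ D₂) →
    (∀ z → ∑[ x < a ] ∑[ y < b ] w x y z ≡ D₃) →
    ∀ {x y z} → x < a → y < b → z < c → 0 < w x y z → FracBalanced support
  support-fracBalanced marginal₁ marginal₂ marginal₃ {x} {y} {z} x<a y<b z<c 0<w =
    weighting , All.universal (λ e → fromℕ-nonNeg (weightOf e)) _ , (e₀ , e₀∈ , fromℕ-≢0 0<w₀) ,
    constant (deg₁ support weighting) deg₁-support marginal₁ ,
    constant (deg₂ support weighting) deg₂-support marginal₂ ,
    constant (deg₃ support weighting) deg₃-support marginal₃
    where
    constant : ∀ {n D} (deg : Fin n → ℚ) {M : ℕ → ℕ} →
      (∀ v → deg v ≡ fromℕ (M (toℕ v))) → (∀ u → M u ≡ D) → ∀ v v′ → deg v ≡ deg v′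
    constant deg deg≡M M≡D v v′ =
      trans (deg≡M v) (trans (cong fromℕ (trans (M≡D _) (sym (M≡D _)))) (sym (deg≡M v′)))
    e₀ : Edge a b c
    e₀ = fromℕ< x<a , fromℕ< y<b , fromℕ< z<c
    0<w₀ : 0 < weightOf e₀
    0<w₀ = subst (0 <_) (sym (cong₃ w (toℕ-fromℕ< x<a) (toℕ-fromℕ< y<b) (toℕ-fromℕ< z<c))) 0<w
      where
      cong₃ : ∀ (f : ℕ → ℕ → ℕ → ℕ) {x x′ y y′ z z′} → x ≡ x′ → y ≡ y′ → z ≡ z′ → f x y z ≡ f x′ y′ z′
      cong₃ f refl refl refl = refl
    e₀∈ : e₀ ∈ edges support
    e₀∈ = ∈-filter⁺ (λ e → 0 <? weightOf e)
      (∈-cartesianProduct⁺ (∈-allFin _) (∈-cartesianProduct⁺ (∈-allFin _) (∈-allFin _))) 0<w₀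

-- Bounding matchings by labels

AllPairs-lookup : ∀ {A : Set} {R : A → A → Set} {xs : List A} → AllPairs R xs →
  ∀ {i j} → i Fin.< j → R (lookup xs i) (lookup xs j)
AllPairs-lookup (Rx ∷ _)   {Fin.zero}  {Fin.suc j} _         = All.lookup Rx (∈-lookup j)
AllPairs-lookup (_  ∷ Rxs) {Fin.suc i} {Fin.suc j} (s<s i<j) = AllPairs-lookup Rxs i<j

AllPairs-restrict : ∀ {A : Set} {P : A → Set} {R S : A → A → Set} {xs : List A} →
  (∀ {x y} → P x → P y → R x y → S x y) → All P xs → AllPairs R xs → AllPairs S xs
AllPairs-restrict R⇒S []         []         = []
AllPairs-restrict R⇒S (px ∷ pxs) (Rx ∷ Rxs) =
  All.zipWith (λ (py , Rxy) → R⇒S px py Rxy) (pxs , Rx) ∷ AllPairs-restrict R⇒S pxs Rxs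

length-distinct-< : ∀ {m} {xs : List ℕ} → AllPairs _≢_ xs → All (_< m) xs → length xs ≤ m
length-distinct-< {m} {xs} distinct bounded with length xs ≤? m
... | yes |xs|≤m = |xs|≤m
... | no  |xs|≰m
  with i , j , i<j , fi≡fj ← pigeonhole (≰⇒> |xs|≰m) (λ i → fromℕ< (All.lookup bounded (∈-lookup i))) =
  contradiction (trans (sym (toℕ-fromℕ< _)) (trans (cong toℕ fi≡fj) (toℕ-fromℕ< _)))
    (AllPairs-lookup distinct i<j)

MatchingNumber≤-byLabel : ∀ {a b c} (H : Hypergraph a b c) {m} (label : Edge a b c → ℕ) →
  (∀ {e} → e ∈ edges H → label e < m) →
  (∀ {e e′} → e ∈ edges H → e′ ∈ edges H → Disjoint e e′ → label e ≢ label e′) →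
  MatchingNumber≤ H m
MatchingNumber≤-byLabel H {m} label bounded separating M (M⊆H , disjoint) =
  subst (_≤ m) (length-map label M)
    (length-distinct-< (AllPairs.map⁺ (AllPairs-restrict separating M⊆H disjoint)) (All.map⁺ (All.map bounded M⊆H)))

-- The even-weight code on a block

block : ℕ → Bool → ℕ
block i false = i + i
block i true  = suc (i + i)

block-< : ∀ {g} i α → i < g → block i α < g + g
block-< {g} i false i<g = ≤-trans (n≤1+n _) (block-< i true i<g)
block-< {g} i true  i<g = subst (_≤ g + g) (cong suc (+-suc i i)) (+-mono-≤ i<g i<g)

⌊block/2⌋ : ∀ i α → ⌊ block i α /2⌋ ≡ i
⌊block/2⌋ i       false = sym (n≡⌊n+n/2⌋ i)
⌊block/2⌋ zero    true  = refl
⌊block/2⌋ (suc i) true  = trans (cong (λ m → ⌊ suc (suc m) /2⌋) (+-suc i i)) (cong suc (⌊block/2⌋ i true))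

∑-blocks : ∀ g (F : ℕ → ℕ) → ∑[ i < g ] (F (block i false) + F (block i true)) ≡ ∑[ j < g + g ] F j
∑-blocks zero    F = refl
∑-blocks (suc g) F = begin
  F 0 + F 1 + ∑[ i < g ] (F (block (suc i) false) + F (block (suc i) true))
    ≡⟨ cong (F 0 + F 1 +_) (∑-cong g (λ i _ → cong₂ (λ x y → F x + F y) (cong suc (+-suc i i)) (cong (suc ∘ suc) (+-suc i i)))) ⟩
  F 0 + F 1 + ∑[ i < g ] (F (2 + block i false) + F (2 + block i true))
    ≡⟨ cong (F 0 + F 1 +_) (∑-blocks g (λ j → F (2 + j))) ⟩
  F 0 + F 1 + ∑[ j < g + g ] F (2 + j)
    ≡⟨ +-assoc (F 0) (F 1) _ ⟩
  F 0 + (F 1 + ∑[ j < g + g ] F (2 + j))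
    ≡⟨ cong (λ m → F 0 + ∑[ j < m ] F (suc j)) (sym (+-suc g g)) ⟩
  ∑[ j < suc g + suc g ] F j ∎
  where open ≡-Reasoning

evenCode : (x y z : Bool → ℕ) → ℕ
evenCode x y z = x false * y false * z false + x false * y true * z true
               + x true * y false * z true + x true * y true * z false

evenCode-swap : ∀ x y z → evenCode x y z ≡ evenCode y x z
evenCode-swap x y z = swap (x false) (x true) (y false) (y true) (z false) (z true)
  where
  swap : ∀ x₀ x₁ y₀ y₁ z₀ z₁ →
    x₀ * y₀ * z₀ + x₀ * y₁ * z₁ + x₁ * y₀ * z₁ + x₁ * y₁ * z₀ ≡
    y₀ * x₀ * z₀ + y₀ * x₁ * z₁ + y₁ * x₀ * z₁ + y₁ * x₁ * z₀
  swap = solve-∀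

evenCode-rotate : ∀ x y z → evenCode x y z ≡ evenCode z x y
evenCode-rotate x y z = rotate (x false) (x true) (y false) (y true) (z false) (z true)
  where
  rotate : ∀ x₀ x₁ y₀ y₁ z₀ z₁ →
    x₀ * y₀ * z₀ + x₀ * y₁ * z₁ + x₁ * y₀ * z₁ + x₁ * y₁ * z₀ ≡
    z₀ * x₀ * y₀ + z₀ * x₁ * y₁ + z₁ * x₀ * y₁ + z₁ * x₁ * y₀
  rotate = solve-∀

evenCode-marginal : ∀ n m (x : Bool → ℕ) (q : Bool → ℕ) → (∀ α → q α < n) → (∀ α → q α < m) →
  ∑[ b < n ] ∑[ c < m ] evenCode x (δ b ∘ q) (δ c ∘ q) ≡ 2 * (x false + x true)
evenCode-marginal n m x q q<n q<m =
  trans (∑∑-distrib-+ n m _ _) (trans (cong₂ _+_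
    (trans (∑∑-distrib-+ n m _ _) (cong₂ _+_
      (trans (∑∑-distrib-+ n m _ _) (cong₂ _+_ (word false false false) (word false true true)))
      (word true false true)))
    (word true true false))
  (double (x false) (x true)))
  where
  word : ∀ α β γ → ∑[ b < n ] ∑[ c < m ] (x α * δ b (q β) * δ c (q γ)) ≡ x α
  word α β γ = ∑∑-δδ n m (x α) (q β) (q γ) (q<n β) (q<m γ)
  double : ∀ x₀ x₁ → x₀ + x₀ + x₁ + x₁ ≡ 2 * (x₀ + x₁)
  double = solve-∀

EvenWord : Bool → Bool → Bool → Set
EvenWord α β γ = α xor β xor γ ≡ false

EvenWord-complement : ∀ {α β γ α′ β′ γ′} → EvenWord α β γ →
  α′ ≡ not α → β′ ≡ not β → γ′ ≡ not γ → ¬ EvenWord α′ β′ γ′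
EvenWord-complement {α} {β} {γ} even refl refl refl = not-¬ (begin
  not α xor not β xor not γ    ≡⟨ cong (not α xor_) (sym (not-distribˡ-xor β (not γ))) ⟩
  not α xor not (β xor not γ)  ≡⟨ cong (λ x → not α xor not x) (sym (not-distribʳ-xor β γ)) ⟩
  not α xor not (not (β xor γ)) ≡⟨ cong (not α xor_) (not-involutive (β xor γ)) ⟩
  not α xor β xor γ            ≡⟨ sym (not-distribˡ-xor α (β xor γ)) ⟩
  not (α xor β xor γ)          ≡⟨ cong not even ⟩
  true                         ∎)
  where open ≡-Reasoning

EvenCodeEdge : ℕ → ℕ → ℕ → ℕ → Set
EvenCodeEdge i a b c = ∃[ α ] ∃[ β ] ∃[ γ ] (EvenWord α β γ × a ≡ block i α × b ≡ block i β × c ≡ block i γ)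

EvenCodeEdges-intersect : ∀ {i a b c a′ b′ c′} → EvenCodeEdge i a b c → EvenCodeEdge i a′ b′ c′ →
  a ≢ a′ → b ≢ b′ → c ≢ c′ → ⊥
EvenCodeEdges-intersect {i} (α , β , γ , even , refl , refl , refl) (α′ , β′ , γ′ , even′ , refl , refl , refl) a≢a′ b≢b′ c≢c′ =
  EvenWord-complement even (flipped α α′ a≢a′) (flipped β β′ b≢b′) (flipped γ γ′ c≢c′) even′
  where
  flipped : ∀ α α′ → block i α ≢ block i α′ → α′ ≡ not α
  flipped α α′ ne = ¬-not (λ α′≡α → ne (cong (block i) (sym α′≡α)))

evenCodeWord-positive : ∀ i a b c α β γ → EvenWord α β γ →
  0 < δ a (block i α) * δ b (block i β) * δ c (block i γ) → EvenCodeEdge i a b c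
evenCodeWord-positive i a b c α β γ even 0<T = α , β , γ , even , δδδ-positive a b c _ _ _ 0<T

evenCode-positive : ∀ i a b c → 0 < evenCode (δ a ∘ block i) (δ b ∘ block i) (δ c ∘ block i) → EvenCodeEdge i a b c
evenCode-positive i a b c 0<code with +-positive _ _ 0<code
... | inj₂ 0<T₁₁₀ = evenCodeWord-positive i a b c true true false refl 0<T₁₁₀
... | inj₁ 0<T′ with +-positive _ _ 0<T′
...   | inj₂ 0<T₁₀₁ = evenCodeWord-positive i a b c true false true refl 0<T₁₀₁
...   | inj₁ 0<T″ with +-positive _ _ 0<T″
...     | inj₁ 0<T₀₀₀ = evenCodeWord-positive i a b c false false false refl 0<T₀₀₀
...     | inj₂ 0<T₀₁₁ = evenCodeWord-positive i a b c false true true refl 0<T₀₁₁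

-- The construction

module Construction (g t d : ℕ) where

  blocks K s N : ℕ
  blocks = g + g
  K      = blocks + t
  s      = t + suc d
  N      = K + suc d

  gadget : ℕ → ℕ → ℕ → ℕ → ℕ
  gadget i a b c = evenCode (δ a ∘ block i) (δ b ∘ block i) (δ c ∘ block i)

  gadgets : ℕ → ℕ → ℕ → ℕ
  gadgets a b c = ∑[ i < g ] gadget i a b c

  low free : ℕ → ℕ
  low  v = if does (v <? blocks) then 1 else 0
  free v = if does (v <? blocks) then 0 else 1

  fillerWeight : ℕ → ℕ
  fillerWeight a = 2 * suc d + 2 * K * free a

  -- Gadget vertices have degree 2 K s² inside their gadget; the filler weight 2(d+1), raised
  -- to 2N = 2(d+1) + 2K when a ≥ 2g, brings side 1 to degree 2 N s² and sides 2, 3 to 2 K s².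
  weight : ℕ → ℕ → ℕ → ℕ
  weight a b c = K * (s * s) * gadgets a b c + fillerWeight a * free b * free c

  gadgets-marginal : ∀ n m v → blocks ≤ n → blocks ≤ m → ∑[ b < n ] ∑[ c < m ] gadgets v b c ≡ 2 * low v
  gadgets-marginal n m v blocks≤n blocks≤m = begin
    ∑[ b < n ] ∑[ c < m ] ∑[ i < g ] gadget i v b c
      ≡⟨ trans (∑-cong n (λ b _ → ∑-comm m g _)) (∑-comm n g _) ⟩
    ∑[ i < g ] ∑[ b < n ] ∑[ c < m ] gadget i v b c
      ≡⟨ ∑-cong g (λ i i<g → evenCode-marginal n m (δ v ∘ block i) (block i)
           (λ α → ≤-trans (block-< i α i<g) blocks≤n) (λ α → ≤-trans (block-< i α i<g) blocks≤m)) ⟩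
    ∑[ i < g ] (2 * (δ v (block i false) + δ v (block i true)))
      ≡⟨ *-distribˡ-∑ g 2 _ ⟩
    2 * ∑[ i < g ] (δ v (block i false) + δ v (block i true))
      ≡⟨ cong (2 *_) (trans (∑-blocks g (δ v)) (∑-δ blocks v)) ⟩
    2 * low v ∎
    where open ≡-Reasoning

  gadgets-swap : ∀ a b c → gadgets a b c ≡ gadgets b a c
  gadgets-swap a b c = ∑-cong g (λ i _ → evenCode-swap (δ a ∘ block i) (δ b ∘ block i) (δ c ∘ block i))

  gadgets-rotate : ∀ a b c → gadgets a b c ≡ gadgets c a b
  gadgets-rotate a b c = ∑-cong g (λ i _ → evenCode-rotate (δ a ∘ block i) (δ b ∘ block i) (δ c ∘ block i))

  ∑-free-N : ∑[ b < N ] free b ≡ s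
  ∑-free-N = trans (∑-count-≥ N blocks) (trans (cong (_∸ blocks) (+-assoc blocks t (suc d))) (m+n∸m≡n blocks s))

  ∑-fillerWeight : ∑[ a < K ] fillerWeight a ≡ 2 * K * s
  ∑-fillerWeight = begin
    ∑[ a < K ] (2 * suc d + 2 * K * free a)        ≡⟨ ∑-distrib-+ K _ _ ⟩
    ∑[ a < K ] (2 * suc d) + ∑[ a < K ] (2 * K * free a)
      ≡⟨ cong₂ _+_ (∑-const K (2 * suc d)) (*-distribˡ-∑ K (2 * K) free) ⟩
    K * (2 * suc d) + 2 * K * ∑[ a < K ] free a   ≡⟨ cong (λ x → K * (2 * suc d) + 2 * K * x) (trans (∑-count-≥ K blocks) (m+n∸m≡n blocks t)) ⟩
    K * (2 * suc d) + 2 * K * t                   ≡⟨ identity K t d ⟩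
    2 * K * s ∎
    where
    open ≡-Reasoning
    identity : ∀ K t d → K * (2 * suc d) + 2 * K * t ≡ 2 * K * (t + suc d)
    identity = solve-∀

  blocks≤K : blocks ≤ K
  blocks≤K = m≤m+n blocks t

  blocks≤N : blocks ≤ N
  blocks≤N = ≤-trans blocks≤K (m≤m+n K (suc d))

  weight-marginal₁ : ∀ v → ∑[ b < N ] ∑[ c < N ] weight v b c ≡ 2 * N * (s * s)
  weight-marginal₁ v = begin
    ∑[ b < N ] ∑[ c < N ] weight v b c
      ≡⟨ ∑∑-linear N N (K * (s * s)) _ _ ⟩
    K * (s * s) * ∑[ b < N ] ∑[ c < N ] gadgets v b c + ∑[ b < N ] ∑[ c < N ] (fillerWeight v * free b * free c)
      ≡⟨ cong₂ (λ x y → K * (s * s) * x + y) (gadgets-marginal N N v blocks≤N blocks≤N)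
           (trans (∑∑-* N N (λ b → fillerWeight v * free b) free)
                  (cong₂ _*_ (trans (*-distribˡ-∑ N (fillerWeight v) free) (cong (fillerWeight v *_) ∑-free-N)) ∑-free-N)) ⟩
    K * (s * s) * (2 * low v) + fillerWeight v * s * s
      ≡⟨ balance (does (v <? blocks)) ⟩
    2 * N * (s * s) ∎
    where
    open ≡-Reasoning
    balance : ∀ B → K * (s * s) * (2 * (if B then 1 else 0)) + (2 * suc d + 2 * K * (if B then 0 else 1)) * s * s ≡ 2 * N * (s * s)
    balance true  = identity K s d
      where
      identity : ∀ K s d → K * (s * s) * (2 * 1) + (2 * suc d + 2 * K * 0) * s * s ≡ 2 * (K + suc d) * (s * s)
      identity = solve-∀
    balance false = identity K s d
      where
      identity : ∀ K s d → K * (s * s) * (2 * 0) + (2 * suc d + 2 * K * 1) * s * s ≡ 2 * (K + suc d) * (s * s)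
      identity = solve-∀

  weight-marginal₂ : ∀ v → ∑[ a < K ] ∑[ c < N ] weight a v c ≡ 2 * K * (s * s)
  weight-marginal₂ v = begin
    ∑[ a < K ] ∑[ c < N ] weight a v c
      ≡⟨ ∑∑-linear K N (K * (s * s)) _ _ ⟩
    K * (s * s) * ∑[ a < K ] ∑[ c < N ] gadgets a v c + ∑[ a < K ] ∑[ c < N ] (fillerWeight a * free v * free c)
      ≡⟨ cong₂ (λ x y → K * (s * s) * x + y)
           (trans (∑-cong K (λ a _ → ∑-cong N (λ c _ → gadgets-swap a v c))) (gadgets-marginal K N v blocks≤K blocks≤N))
           (trans (∑∑-* K N (λ a → fillerWeight a * free v) free)
                  (cong₂ _*_ (trans (*-distribʳ-∑ K (free v) fillerWeight) (cong (_* free v) ∑-fillerWeight)) ∑-free-N)) ⟩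
    K * (s * s) * (2 * low v) + 2 * K * s * free v * s
      ≡⟨ balance (does (v <? blocks)) ⟩
    2 * K * (s * s) ∎
    where
    open ≡-Reasoning
    balance : ∀ B → K * (s * s) * (2 * (if B then 1 else 0)) + 2 * K * s * (if B then 0 else 1) * s ≡ 2 * K * (s * s)
    balance true  = identity K s
      where
      identity : ∀ K s → K * (s * s) * (2 * 1) + 2 * K * s * 0 * s ≡ 2 * K * (s * s)
      identity = solve-∀
    balance false = identity K s
      where
      identity : ∀ K s → K * (s * s) * (2 * 0) + 2 * K * s * 1 * s ≡ 2 * K * (s * s)
      identity = solve-∀

  weight-marginal₃ : ∀ v → ∑[ a < K ] ∑[ b < N ] weight a b v ≡ 2 * K * (s * s)
  weight-marginal₃ v = begin
    ∑[ a < K ] ∑[ b < N ] weight a b v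
      ≡⟨ ∑∑-linear K N (K * (s * s)) _ _ ⟩
    K * (s * s) * ∑[ a < K ] ∑[ b < N ] gadgets a b v + ∑[ a < K ] ∑[ b < N ] (fillerWeight a * free b * free v)
      ≡⟨ cong₂ (λ x y → K * (s * s) * x + y)
           (trans (∑-cong K (λ a _ → ∑-cong N (λ b _ → gadgets-rotate a b v))) (gadgets-marginal K N v blocks≤K blocks≤N))
           (trans (∑-cong K (λ a _ → ∑-cong N (λ b _ → *-assoc (fillerWeight a) (free b) (free v))))
             (trans (∑∑-* K N fillerWeight (λ b → free b * free v))
                    (cong₂ _*_ ∑-fillerWeight (trans (*-distribʳ-∑ N (free v) free) (cong (_* free v) ∑-free-N))))) ⟩
    K * (s * s) * (2 * low v) + 2 * K * s * (s * free v)
      ≡⟨ balance (does (v <? blocks)) ⟩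
    2 * K * (s * s) ∎
    where
    open ≡-Reasoning
    balance : ∀ B → K * (s * s) * (2 * (if B then 1 else 0)) + 2 * K * s * (s * (if B then 0 else 1)) ≡ 2 * K * (s * s)
    balance true  = identity K s
      where
      identity : ∀ K s → K * (s * s) * (2 * 1) + 2 * K * s * (s * 0) ≡ 2 * K * (s * s)
      identity = solve-∀
    balance false = identity K s
      where
      identity : ∀ K s → K * (s * s) * (2 * 0) + 2 * K * s * (s * 1) ≡ 2 * K * (s * s)
      identity = solve-∀

  open Support {K} {N} {N} weight

  free-positive : ∀ b → 0 < free b → blocks ≤ b
  free-positive b 0<free = ≮⇒≥ (λ b<blocks →
    <-irrefl refl (subst (λ B → 0 < (if B then 0 else 1)) (dec-true (b <? blocks) b<blocks) 0<free))

  free-blocks : free blocks ≡ 1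
  free-blocks = cong (if_then 0 else 1) (dec-false (blocks <? blocks) (<-irrefl refl))

  weight-positive : ∀ a b c → 0 < weight a b c → blocks ≤ b ⊎ ∃[ i ] (i < g × EvenCodeEdge i a b c)
  weight-positive a b c 0<w with +-positive _ _ 0<w
  ... | inj₂ 0<filler = inj₁ (free-positive b (proj₂ (*-positive (fillerWeight a) (free b) (proj₁ (*-positive (fillerWeight a * free b) (free c) 0<filler)))))
  ... | inj₁ 0<gadgets with ∑-positive g _ (proj₂ (*-positive (K * (s * s)) _ 0<gadgets))
  ...   | i , i<g , 0<gadget = inj₂ (i , i<g , evenCode-positive i a b c 0<gadget)

  blocks<N : blocks < N
  blocks<N = ≤-<-trans blocks≤K (m<m+n K z<s)

  fracBalanced : 0 < K → FracBalanced support
  fracBalanced 0<K = support-fracBalanced weight-marginal₁ weight-marginal₂ weight-marginal₃ 0<K blocks<N blocks<N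
    (<-≤-trans (subst (λ x → 0 < fillerWeight 0 * x * x) (sym free-blocks) z<s) (m≤n+m _ _))

  -- An injective labelling of the edges of a matching: an edge through a free vertex b
  -- gets b − 2g < s, an edge of gadget i gets s + i, and two edges of one gadget intersect.
  column : ℕ → ℕ
  column b = if does (b <? blocks) then s + ⌊ b /2⌋ else b ∸ blocks

  N∸blocks≡s : N ∸ blocks ≡ s
  N∸blocks≡s = trans (cong (_∸ blocks) (+-assoc blocks t (suc d))) (m+n∸m≡n blocks s)

  column-free : ∀ {b} → blocks ≤ b → column b ≡ b ∸ blocks
  column-free {b} blocks≤b = cong (if_then s + ⌊ b /2⌋ else b ∸ blocks) (dec-false (b <? blocks) (≤⇒≯ blocks≤b))

  column-free-< : ∀ {b} → blocks ≤ b → b < N → column b < s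
  column-free-< blocks≤b b<N =
    subst₂ _<_ (sym (column-free blocks≤b)) N∸blocks≡s (∸-monoˡ-< b<N blocks≤b)

  column-gadget : ∀ {i a b c} → i < g → EvenCodeEdge i a b c → column b ≡ s + i
  column-gadget {i} i<g (_ , β , _ , _ , _ , refl , _) =
    trans (cong (if_then s + ⌊ block i β /2⌋ else block i β ∸ blocks) (dec-true (block i β <? blocks) (block-< i β i<g)))
          (cong (s +_) (⌊block/2⌋ i β))

  Kind : ℕ → ℕ → ℕ → Set
  Kind a b c = blocks ≤ b ⊎ ∃[ i ] (i < g × EvenCodeEdge i a b c)

  column-< : ∀ {a b c} → b < N → Kind a b c → column b < s + g
  column-< b<N (inj₁ blocks≤b)       = ≤-trans (column-free-< blocks≤b b<N) (m≤m+n s g)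
  column-< b<N (inj₂ (i , i<g , ge)) = subst (_< s + g) (sym (column-gadget i<g ge)) (+-monoʳ-< s i<g)

  column-separates : ∀ {a b c a′ b′ c′} → b < N → b′ < N → Kind a b c → Kind a′ b′ c′ →
    a ≢ a′ → b ≢ b′ → c ≢ c′ → column b ≢ column b′
  column-separates b<N b′<N (inj₁ ≤b) (inj₁ ≤b′) _ b≢b′ _ eq =
    b≢b′ (∸-cancelʳ-≡ ≤b ≤b′ (trans (sym (column-free ≤b)) (trans eq (column-free ≤b′))))
  column-separates b<N b′<N (inj₁ ≤b) (inj₂ (i′ , i′<g , ge′)) _ _ _ eq =
    <⇒≱ (column-free-< ≤b b<N) (subst (s ≤_) (trans (sym (column-gadget i′<g ge′)) (sym eq)) (m≤m+n s i′))
  column-separates b<N b′<N (inj₂ (i , i<g , ge)) (inj₁ ≤b′) _ _ _ eq =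
    <⇒≱ (column-free-< ≤b′ b′<N) (subst (s ≤_) (trans (sym (column-gadget i<g ge)) eq) (m≤m+n s i))
  column-separates b<N b′<N (inj₂ (i , i<g , ge)) (inj₂ (i′ , i′<g , ge′)) a≢a′ b≢b′ c≢c′ eq
    with +-cancelˡ-≡ s i i′ (trans (sym (column-gadget i<g ge)) (trans eq (column-gadget i′<g ge′)))
  ... | refl = EvenCodeEdges-intersect ge ge′ a≢a′ b≢b′ c≢c′

  kind : ∀ {e} → e ∈ edges support → Kind (toℕ (proj₁ e)) (toℕ (proj₁ (proj₂ e))) (toℕ (proj₂ (proj₂ e)))
  kind e∈ = weight-positive _ _ _ (∈support⇒positive e∈)

  matchingNumber≤K : MatchingNumber≤ support K
  matchingNumber≤K = MatchingNumber≤-byLabel support (λ e → toℕ (proj₁ e))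
    (λ {e} _ → toℕ<n (proj₁ e)) (λ _ _ (a≢a′ , _) eq → a≢a′ (toℕ-injective eq))

  matchingNumber≤s+g : MatchingNumber≤ support (s + g)
  matchingNumber≤s+g = MatchingNumber≤-byLabel support (λ e → column (toℕ (proj₁ (proj₂ e))))
    (λ {e} e∈ → column-< (toℕ<n (proj₁ (proj₂ e))) (kind e∈))
    (λ {e} {e′} e∈ e′∈ (a≢a′ , b≢b′ , c≢c′) → column-separates (toℕ<n (proj₁ (proj₂ e))) (toℕ<n (proj₁ (proj₂ e′)))
       (kind e∈) (kind e′∈) (a≢a′ ∘ toℕ-injective) (b≢b′ ∘ toℕ-injective) (c≢c′ ∘ toℕ-injective))

  bm≤-construction : 0 < K → bm≤ K N N (K ⊓ (s + g))
  bm≤-construction 0<K = support , fracBalanced 0<K ,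
    λ M M-matching → ⊓-glb (matchingNumber≤K M M-matching) (matchingNumber≤s+g M M-matching)

  s+g≡N∸g : s + g ≡ N ∸ g
  s+g≡N∸g = trans (+-comm s g) (sym (trans (cong (_∸ g) (regroup g t d)) (m+n∸m≡n g (g + s))))
    where
    regroup : ∀ g t d → g + g + t + suc d ≡ g + (g + (t + suc d))
    regroup = solve-∀

-- Choosing the parameters

bm≤-mono : ∀ {a b c x y} → x ≤ y → bm≤ a b c x → bm≤ a b c y
bm≤-mono x≤y (H , H-balanced , ν≤x) = H , H-balanced , λ M M-matching → ≤-trans (ν≤x M M-matching) x≤y

bm≤-⊓-∸ : ∀ g k n → g + g ≤ k → k < n → 0 < k → bm≤ k n n (k ⊓ (n ∸ g))
bm≤-⊓-∸ g k n 2g≤k k<n 0<k =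
  subst₂ (λ k n → bm≤ k n n (k ⊓ (n ∸ g))) K≡k N≡n
    (subst (λ x → bm≤ K N N (K ⊓ x)) s+g≡N∸g (bm≤-construction (subst (0 <_) (sym K≡k) 0<k)))
  where
  open Construction g (k ∸ (g + g)) (n ∸ suc k)
  K≡k : K ≡ k
  K≡k = m+[n∸m]≡n 2g≤k
  N≡n : N ≡ n
  N≡n = trans (cong (_+ suc (n ∸ suc k)) K≡k) (trans (+-suc k _) (m+[n∸m]≡n k<n))

double-gap≤ : ∀ {k n m} → m < k → k < n → 3 * n ≤ 4 * m + 3 → (n ∸ m) + (n ∸ m) ≤ k
double-gap≤ {k} {n} {m} m<k k<n 3n≤4m+3 = ≤-trans 2u≤1+m m<k
  where
  open ≤-Reasoning
  u = n ∸ m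
  u+m≡n : u + m ≡ n
  u+m≡n = m∸n+n≡m (≤-trans (<⇒≤ m<k) (<⇒≤ k<n))
  3u≤m+3 : 3 * u ≤ m + 3
  3u≤m+3 = +-cancelʳ-≤ (3 * m) (3 * u) (m + 3) (begin
    3 * u + 3 * m  ≡⟨ sym (*-distribˡ-+ 3 u m) ⟩
    3 * (u + m)    ≡⟨ cong (3 *_) u+m≡n ⟩
    3 * n          ≤⟨ 3n≤4m+3 ⟩
    4 * m + 3      ≡⟨ regroup m ⟩
    m + 3 + 3 * m  ∎)
    where
    regroup : ∀ m → 4 * m + 3 ≡ m + 3 + 3 * m
    regroup = solve-∀
  2≤u : 2 ≤ u
  2≤u = +-cancelʳ-≤ m 2 u (subst (2 + m ≤_) (sym u+m≡n) (≤-trans (s≤s m<k) k<n))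
  2u≤1+m : u + u ≤ suc m
  2u≤1+m = +-cancelʳ-≤ 2 (u + u) (suc m) (begin
    u + u + 2  ≤⟨ +-monoʳ-≤ (u + u) 2≤u ⟩
    u + u + u  ≡⟨ triple u ⟩
    3 * u      ≤⟨ 3u≤m+3 ⟩
    m + 3      ≡⟨ +-suc m 2 ⟩
    suc m + 2  ∎)
    where
    triple : ∀ u → u + u + u ≡ 3 * u
    triple = solve-∀

bm≤-⊓ : ∀ k n m → 0 < k → k < n → 3 * n ≤ 4 * m + 3 → bm≤ k n n (k ⊓ m)
bm≤-⊓ k n m 0<k k<n 3n≤4m+3 with k ≤? m
... | yes k≤m = bm≤-mono (⊓-glb (m⊓n≤m k n) (≤-trans (m⊓n≤m k n) k≤m)) (bm≤-⊓-∸ 0 k n z≤n k<n 0<k)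
... | no  k≰m = subst (λ x → bm≤ k n n (k ⊓ x)) (m∸[m∸n]≡n m≤n)
                  (bm≤-⊓-∸ (n ∸ m) k n (double-gap≤ m<k k<n 3n≤4m+3) k<n 0<k)
  where
  m<k = ≰⇒> k≰m
  m≤n = ≤-trans (<⇒≤ m<k) (<⇒≤ k<n)

≤4*[/4]+3 : ∀ x → x ≤ 4 * (x / 4) + 3
≤4*[/4]+3 x = begin
  x                   ≡⟨ m≡m%n+[m/n]*n x 4 ⟩
  x % 4 + x / 4 * 4   ≤⟨ +-monoˡ-≤ (x / 4 * 4) (≤-pred (m%n<n x 4)) ⟩
  3 + x / 4 * 4       ≡⟨ trans (+-comm 3 _) (cong (_+ 3) (*-comm (x / 4) 4)) ⟩
  4 * (x / 4) + 3     ∎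
  where open ≤-Reasoning

theorem6p1 : (k n : ℕ) → 1 ≤ k → k < n →
    (2 ∣ n → bm≤ k n n (k ⊓ ((3 * n) / 4))) ×
    (¬ (2 ∣ n) → bm≤ k n n (k ⊓ ((3 * n + 1) / 4)))
theorem6p1 k n 1≤k k<n =
  (λ _ → bm≤-⊓ k n _ 1≤k k<n (≤4*[/4]+3 (3 * n))) ,
  (λ _ → bm≤-⊓ k n _ 1≤k k<n (≤-trans (m≤m+n (3 * n) 1) (≤4*[/4]+3 (3 * n + 1))))
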